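{- For every $k\in\mathbb{N}$ and every positive integer $n$, $$\sum_{m=0}^{n-1}(2m+1)^2\binom{m+k}{2k}=(4n^2-1)\frac{n-k}{2k+3}\binom{n+k}{2k}.$$ -}

module Defs where

open import Data.Nat using (ℕ; zero; suc; _+_; _*_)

sumBelow : ℕ → (ℕ → ℕ) → ℕ
sumBelow zero    f = 0
sumBelow (suc n) f = sumBelow n f + f n

module Submission where

-- Summation identity
--   (2k+3) · Σ_{m<N} (2m+1)² C(m+k, 2k)  =  (4N²−1)(N−k) C(N+k, 2k)      (N ≥ 0)
-- proved by induction on N, read in ℤ because N − k may be negative.
--
-- The induction step rests on two independent facts.
--  * A binomial fact: the "upper step" (a+1−b) C(a+1,b) = (a+1) C(a,b), derived from
--    Pascal's rule and the absorption identity (b+1) C(a+1,b+1) = (a+1) C(a,b).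
--    With a = N+k, b = 2k it turns (N+1−k) C(N+1+k,2k) into (N+1+k) C(N+k,2k).
--  * A polynomial identity in N and k:
--      (4N²−1)(N−k) + (2k+3)(2N+1)² = (4(N+1)²−1)(N+1+k),
--    checked by the ring solver once the casts ℕ → ℤ have been pushed inwards.
-- Adding the new summand to the closed form at N therefore gives the closed form at N+1;
-- at N = 0 both sides vanish since C(k,2k) = 0 for k > 0.  The theorem is the case N = n+1.

open import Defs
open import Data.Nat using (ℕ; suc; _+_; _*_; _^_)
open import Data.Nat.Combinatorics using (_C_)
open import Data.Integer using (ℤ; +_; _-_) renaming (_*_ to _*ℤ_)
open import Relation.Binary.PropositionalEquality using (_≡_)

open import Data.List using ([]; _∷_)
open import Data.Nat using (zero; z≤n; s≤s)
open import Data.Nat.Properties using (*-distribˡ-+; *-zeroʳ; +-identityʳ; *-identityˡ; *-identityʳ; +-assoc; +-comm; *-assoc; m<m+n)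
open import Data.Nat.Combinatorics using (k>n⇒nCk≡0; nCk+nC[k+1]≡[n+1]C[k+1]; nC1≡n)
open import Data.Integer using (0ℤ) renaming (_+_ to _+ℤ_)
import Data.Integer.Properties as ℤP
open import Data.Integer.Tactic.RingSolver using (solve-∀; solve)
open import Relation.Binary.PropositionalEquality using (refl; sym; trans; cong; cong₂; module ≡-Reasoning)

absorption : ∀ n k → suc k * (suc n C suc k) ≡ suc n * (n C k)
absorption zero    zero    = refl
absorption zero    (suc k) = *-zeroʳ (suc (suc k))
absorption (suc n) zero    =
  trans (*-identityˡ _) (trans (nC1≡n (suc (suc n))) (sym (*-identityʳ _)))
absorption (suc n) (suc k) = begin
  suc (suc k) * (suc (suc n) C suc (suc k))
    ≡⟨ cong (suc (suc k) *_) (sym (nCk+nC[k+1]≡[n+1]C[k+1] (suc n) (suc k))) ⟩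
  suc (suc k) * (x + w)
    ≡⟨ *-distribˡ-+ (suc (suc k)) x w ⟩
  (x + suc k * x) + suc (suc k) * w
    ≡⟨ +-assoc x (suc k * x) (suc (suc k) * w) ⟩
  x + (suc k * x + suc (suc k) * w)
    ≡⟨ cong (λ t → x + t) (cong₂ _+_ (absorption n k) (absorption n (suc k))) ⟩
  x + (suc n * (n C k) + suc n * (n C suc k))
    ≡⟨ cong (λ t → x + t) (sym (*-distribˡ-+ (suc n) (n C k) (n C suc k))) ⟩
  x + suc n * (n C k + n C suc k)
    ≡⟨ cong (λ t → x + suc n * t) (nCk+nC[k+1]≡[n+1]C[k+1] n k) ⟩
  suc (suc n) * x ∎
  where
  open ≡-Reasoning
  x = suc n C suc k
  w = suc n C suc (suc k)

upperStep : ∀ a b → suc a * (suc a C b) ≡ suc a * (a C b) + b * (suc a C b)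
upperStep a zero    = sym (+-identityʳ (suc a * 1))
upperStep a (suc b) = begin
  suc a * (suc a C suc b)
    ≡⟨ cong (suc a *_) (sym (nCk+nC[k+1]≡[n+1]C[k+1] a b)) ⟩
  suc a * (a C b + a C suc b)
    ≡⟨ *-distribˡ-+ (suc a) (a C b) (a C suc b) ⟩
  suc a * (a C b) + suc a * (a C suc b)
    ≡⟨ cong (_+ suc a * (a C suc b)) (sym (absorption a b)) ⟩
  suc b * (suc a C suc b) + suc a * (a C suc b)
    ≡⟨ +-comm (suc b * (suc a C suc b)) (suc a * (a C suc b)) ⟩
  suc a * (a C suc b) + suc b * (suc a C suc b) ∎
  where open ≡-Reasoning

subtractTerm : ∀ (A B c c′ : ℤ) → A *ℤ c′ ≡ A *ℤ c +ℤ B *ℤ c′ → (A - B) *ℤ c′ ≡ A *ℤ c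
subtractTerm A B c c′ eq = begin
  (A - B) *ℤ c′                 ≡⟨ solve (A ∷ B ∷ c′ ∷ []) ⟩
  A *ℤ c′ - B *ℤ c′             ≡⟨ cong (_- B *ℤ c′) eq ⟩
  (A *ℤ c +ℤ B *ℤ c′) - B *ℤ c′ ≡⟨ solve (A ∷ B ∷ c ∷ c′ ∷ []) ⟩
  A *ℤ c                        ∎
  where open ≡-Reasoning

-- Upper step in ℤ: (a+1−b) C(a+1,b) = (a+1) C(a,b), where a+1−b may be ≤ 0.
upperStepℤ : ∀ a b → (+ suc a - + b) *ℤ + (suc a C b) ≡ + suc a *ℤ + (a C b)
upperStepℤ a b = subtractTerm (+ suc a) (+ b) (+ (a C b)) (+ (suc a C b))
  (trans (sym (ℤP.pos-* (suc a) (suc a C b)))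
  (trans (cong +_ (upperStep a b))
  (trans (ℤP.pos-+ (suc a * (a C b)) (b * (suc a C b)))
         (cong₂ _+ℤ_ (ℤP.pos-* (suc a) (a C b)) (ℤP.pos-* b (suc a C b))))))

centralVanishes : ∀ j → suc j C (2 * suc j) ≡ 0
centralVanishes j = k>n⇒nCk≡0 (m<m+n (suc j) (s≤s z≤n))

-- The cast ℕ → ℤ commutes with affine maps and squares; these push it down to the atoms
-- so that the ring solver can see the polynomial structure.
pos-affine : ∀ a x b → + (a * x + b) ≡ + a *ℤ + x +ℤ + b
pos-affine a x b = trans (ℤP.pos-+ (a * x) b) (cong (_+ℤ + b) (ℤP.pos-* a x))


pos-square : ∀ x → + (x ^ 2) ≡ + x *ℤ + x
pos-square x = trans (ℤP.pos-* x (x * 1)) (cong (λ t → + x *ℤ + t) (*-identityʳ x))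

fourSquareMinusOne : ℕ → ℤ
fourSquareMinusOne N = + (4 * N ^ 2) - + 1

fourSquareMinusOne-poly : ∀ N → fourSquareMinusOne N ≡ + 4 *ℤ (+ N *ℤ + N) - + 1
fourSquareMinusOne-poly N =
  cong (_- + 1) (trans (ℤP.pos-* 4 (N ^ 2)) (cong (+ 4 *ℤ_) (pos-square N)))

stepPolynomialℤ : ∀ (M K : ℤ) →
  (+ 4 *ℤ (M *ℤ M) - + 1) *ℤ (M - K) +ℤ (+ 2 *ℤ K +ℤ + 3) *ℤ ((+ 2 *ℤ M +ℤ + 1) *ℤ (+ 2 *ℤ M +ℤ + 1))
    ≡ (+ 4 *ℤ ((+ 1 +ℤ M) *ℤ (+ 1 +ℤ M)) - + 1) *ℤ ((+ 1 +ℤ M) +ℤ K)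
stepPolynomialℤ = solve-∀

stepPolynomial : ∀ N k →
  fourSquareMinusOne N *ℤ (+ N - + k) +ℤ + ((2 * k + 3) * (2 * N + 1) ^ 2)
    ≡ fourSquareMinusOne (suc N) *ℤ + (suc N + k)
stepPolynomial N k = begin
  fourSquareMinusOne N *ℤ (M - K) +ℤ + ((2 * k + 3) * (2 * N + 1) ^ 2)
    ≡⟨ cong₂ (λ p q → p *ℤ (M - K) +ℤ q) (fourSquareMinusOne-poly N) newTerm ⟩
  (+ 4 *ℤ (M *ℤ M) - + 1) *ℤ (M - K) +ℤ (+ 2 *ℤ K +ℤ + 3) *ℤ ((+ 2 *ℤ M +ℤ + 1) *ℤ (+ 2 *ℤ M +ℤ + 1))
    ≡⟨ stepPolynomialℤ M K ⟩
  (+ 4 *ℤ ((+ 1 +ℤ M) *ℤ (+ 1 +ℤ M)) - + 1) *ℤ ((+ 1 +ℤ M) +ℤ K)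
    ≡⟨ sym (cong₂ _*ℤ_ nextFactor nextSum) ⟩
  fourSquareMinusOne (suc N) *ℤ + (suc N + k) ∎
  where
  open ≡-Reasoning
  M = + N
  K = + k
  newTerm : + ((2 * k + 3) * (2 * N + 1) ^ 2)
            ≡ (+ 2 *ℤ K +ℤ + 3) *ℤ ((+ 2 *ℤ M +ℤ + 1) *ℤ (+ 2 *ℤ M +ℤ + 1))
  newTerm = trans (ℤP.pos-* (2 * k + 3) ((2 * N + 1) ^ 2))
    (cong₂ _*ℤ_ (pos-affine 2 k 3)
                (trans (pos-square (2 * N + 1)) (cong (λ t → t *ℤ t) (pos-affine 2 N 1))))
  nextFactor : fourSquareMinusOne (suc N) ≡ + 4 *ℤ ((+ 1 +ℤ M) *ℤ (+ 1 +ℤ M)) - + 1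
  nextFactor = trans (fourSquareMinusOne-poly (suc N))
    (cong (λ t → + 4 *ℤ (t *ℤ t) - + 1) (ℤP.pos-+ 1 N))
  nextSum : + (suc N + k) ≡ (+ 1 +ℤ M) +ℤ K
  nextSum = trans (ℤP.pos-+ (suc N) k) (cong (_+ℤ K) (ℤP.pos-+ 1 N))

binomialShift : ∀ N k →
  (+ suc N - + k) *ℤ + ((suc N + k) C (2 * k)) ≡ + (suc N + k) *ℤ + ((N + k) C (2 * k))
binomialShift N k =
  trans (cong (_*ℤ + ((suc N + k) C (2 * k))) (sym sameFactor)) (upperStepℤ (N + k) (2 * k))
  where
  cancelTwice : ∀ (S K : ℤ) → S +ℤ K - + 2 *ℤ K ≡ S - K
  cancelTwice = solve-∀
  sameFactor : + suc (N + k) - + (2 * k) ≡ + suc N - + k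
  sameFactor = trans (cong₂ _-_ (ℤP.pos-+ (suc N) k) (ℤP.pos-* 2 k))
                     (cancelTwice (+ suc N) (+ k))

summand : ℕ → ℕ → ℕ
summand k m = (2 * m + 1) ^ 2 * ((m + k) C (2 * k))

closedForm : ℕ → ℕ → ℤ
closedForm k N = fourSquareMinusOne N *ℤ (+ N - + k) *ℤ + ((N + k) C (2 * k))

closedForm-zero : ∀ k → closedForm k 0 ≡ 0ℤ
closedForm-zero zero    = refl
closedForm-zero (suc j) =
  trans (cong (λ t → fourSquareMinusOne 0 *ℤ (+ 0 - + suc j) *ℤ + t) (centralVanishes j))
        (ℤP.*-zeroʳ (fourSquareMinusOne 0 *ℤ (+ 0 - + suc j)))

closedForm-step : ∀ k N → closedForm k N +ℤ + ((2 * k + 3) * summand k N) ≡ closedForm k (suc N)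
closedForm-step k N = begin
  P N *ℤ (M - K) *ℤ c +ℤ + ((2 * k + 3) * ((2 * N + 1) ^ 2 * c₀))
    ≡⟨ cong (λ t → P N *ℤ (M - K) *ℤ c +ℤ t) newTerm ⟩
  P N *ℤ (M - K) *ℤ c +ℤ + q *ℤ c
    ≡⟨ sym (ℤP.*-distribʳ-+ c (P N *ℤ (M - K)) (+ q)) ⟩
  (P N *ℤ (M - K) +ℤ + q) *ℤ c
    ≡⟨ cong (_*ℤ c) (stepPolynomial N k) ⟩
  P (suc N) *ℤ + (suc N + k) *ℤ c
    ≡⟨ ℤP.*-assoc (P (suc N)) (+ (suc N + k)) c ⟩
  P (suc N) *ℤ (+ (suc N + k) *ℤ c)
    ≡⟨ cong (P (suc N) *ℤ_) (sym (binomialShift N k)) ⟩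
  P (suc N) *ℤ ((+ suc N - K) *ℤ c′)
    ≡⟨ sym (ℤP.*-assoc (P (suc N)) (+ suc N - K) c′) ⟩
  closedForm k (suc N) ∎
  where
  open ≡-Reasoning
  P = fourSquareMinusOne
  M = + N
  K = + k
  q = (2 * k + 3) * (2 * N + 1) ^ 2
  c₀ = (N + k) C (2 * k)
  c = + c₀
  c′ = + ((suc N + k) C (2 * k))
  newTerm : + ((2 * k + 3) * ((2 * N + 1) ^ 2 * c₀)) ≡ + q *ℤ c
  newTerm = trans (cong +_ (sym (*-assoc (2 * k + 3) ((2 * N + 1) ^ 2) c₀))) (ℤP.pos-* q c₀)

sumIdentity : ∀ k N → + (2 * k + 3) *ℤ + sumBelow N (summand k) ≡ closedForm k N
sumIdentity k zero    = trans (ℤP.*-zeroʳ (+ (2 * k + 3))) (sym (closedForm-zero k))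
sumIdentity k (suc N) = begin
  A *ℤ + (S + summand k N)
    ≡⟨ cong (A *ℤ_) (ℤP.pos-+ S (summand k N)) ⟩
  A *ℤ (+ S +ℤ + summand k N)
    ≡⟨ ℤP.*-distribˡ-+ A (+ S) (+ summand k N) ⟩
  A *ℤ + S +ℤ A *ℤ + summand k N
    ≡⟨ cong₂ _+ℤ_ (sumIdentity k N) (sym (ℤP.pos-* (2 * k + 3) (summand k N))) ⟩
  closedForm k N +ℤ + ((2 * k + 3) * summand k N)
    ≡⟨ closedForm-step k N ⟩
  closedForm k (suc N) ∎
  where
  open ≡-Reasoning
  A = + (2 * k + 3)
  S = sumBelow N (summand k)

lemma3p3 : ∀ (k n : ℕ) →
    (+ (2 * k + 3)) *ℤ (+ sumBelow (suc n) (λ m → (2 * m + 1) ^ 2 * ((m + k) C (2 * k))))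
      ≡ ((+ (4 * suc n ^ 2)) - (+ 1)) *ℤ ((+ suc n) - (+ k)) *ℤ (+ ((suc n + k) C (2 * k)))
lemma3p3 k n = sumIdentity k (suc n)
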